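{- Let $S$ be a set and $\to\subseteq S\times S$ a binary relation. Let $P^\times,Q^\times\subseteq S\times S$, $F^\times\subseteq(S\times S)\times(S\times S)$, $P,Q\subseteq S$, $F\subseteq S\times S$ and $c_0,c_1:S\to\mathbb{N}$. Suppose that (0) $\mathrm{Ensures2}_{\to}(P^\times,Q^\times,F^\times,c_0,c_1)$ holds; (i) for every $s_1\in P$ there is $s_0$ with $(s_0,s_1)\in P^\times$; (ii) for all $s_0,s_1$, $(s_0,s_1)\in Q^\times$ implies $s_1\in Q$; (iii) there exists $F'\subseteq S\times S$ such that for all $s_0,s_1,s_0',s_1'\in S$, $((s_0,s_1),(s_0',s_1'))\in F^\times\iff\big((s_0,s_0')\in F'\wedge(s_1,s_1')\in F\big)$. Then $\mathrm{EnsuresN}_{\to}(P,Q,F,c_1)$ holds.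
   Context: For $n\in\mathbb{N}$, $\to^n$ denotes the $n$-fold composition of $\to$, with $\to^0$ the identity relation on $S$. For $n\in\mathbb{N}$ and $Q\subseteq S$, $\mathrm{EvN}_{\to}(n,Q)=\{s\in S\mid (\forall s'.\ s\to^n s'\Rightarrow s'\in Q)\wedge(\forall s'\,\forall l<n.\ s\to^l s'\Rightarrow\exists s''.\ s'\to s'')\}$. $\mathrm{EnsuresN}_{\to}(P,Q,F,c)$ (for $P,Q\subseteq S$, $F\subseteq S\times S$, $c:S\to\mathbb{N}$) means: for all $s\in P$, $s\in\mathrm{EvN}_{\to}(c(s),\{s'\mid s'\in Q\wedge(s,s')\in F\})$. For $P,Q\subseteq S\times S$, $F\subseteq(S\times S)\times(S\times S)$ and $c_0,c_1:S\to\mathbb{N}$, $\mathrm{Ensures2}_{\to}(P,Q,F,c_0,c_1)$ means: for all $(s_0,s_1)\in P$, $s_0\in\mathrm{EvN}_{\to}\big(c_0(s_0),\{s_0'\mid s_1\in\mathrm{EvN}_{\to}(c_1(s_1),\{s_1'\mid (s_0',s_1')\in Q\wedge((s_0,s_1),(s_0',s_1'))\in F\})\}\big)$. Conditions (0)–(iii) together constitute the paper's "hybrid relational Hoare triple". -}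

module Defs where

open import Data.Nat using (ℕ; zero; suc; _<_)
open import Data.Product using (Σ; ∃; _×_; _,_)

Pred : Set → Set₁
Pred A = A → Set

Rel : Set → Set₁
Rel A = A → A → Set

data Iter {S : Set} (R : Rel S) : ℕ → S → S → Set where
  iter-zero : ∀ {s} → Iter R zero s s
  iter-suc  : ∀ {n s t u} → R s t → Iter R n t u → Iter R (suc n) s u

EvN : {S : Set} → Rel S → ℕ → Pred S → Pred S
EvN {S} R n Q s =
  (∀ s' → Iter R n s s' → Q s')
  × (∀ s' (l : ℕ) → l < n → Iter R l s s' → ∃ λ s'' → R s' s'')

EnsuresN : {S : Set} → Rel S → Pred S → Pred S → Rel S → (S → ℕ) → Set
EnsuresN R P Q F c =
  ∀ s → P s → EvN R (c s) (λ s' → Q s' × F s s') s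

Ensures2 : {S : Set} → Rel S → Pred (S × S) → Pred (S × S) → Rel (S × S)
         → (S → ℕ) → (S → ℕ) → Set
Ensures2 R P Q F c₀ c₁ =
  ∀ s₀ s₁ → P (s₀ , s₁) →
    EvN R (c₀ s₀)
      (λ s₀' → EvN R (c₁ s₁)
                 (λ s₁' → Q (s₀' , s₁') × F (s₀ , s₁) (s₀' , s₁'))
                 s₁)
      s₀

{-# OPTIONS --safe #-}
module Submission where

open import Defs
open import Data.Nat using (ℕ; zero; suc; _≤_; _<_)
open import Data.Nat.Properties using (≤-refl; <⇒≤)
open import Data.Product using (∃; _×_; _,_; proj₂)
open import Function.Bundles using (_⇔_; Equivalence)

-- Since the left run is guaranteed to progress for c₀ s₀ steps, it reaches some
-- state s₀'; the inner guarantee at s₀' is a statement about the right run alone,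
-- and projecting the product frame condition onto its second factor yields F.

Iter-snoc : ∀ {S : Set} {R : Rel S} {m s t u} → Iter R m s t → R t u → Iter R (suc m) s u
Iter-snoc iter-zero        r = iter-suc r iter-zero
Iter-snoc (iter-suc r′ it) r = iter-suc r′ (Iter-snoc it r)

progress⇒Iter : ∀ {S : Set} {R : Rel S} {n s} →
  (∀ s' (l : ℕ) → l < n → Iter R l s s' → ∃ λ s'' → R s' s'') →
  ∀ m → m ≤ n → ∃ λ t → Iter R m s t
progress⇒Iter {s = s} progress zero    _   = s , iter-zero
progress⇒Iter         progress (suc m) m<n with progress⇒Iter progress m (<⇒≤ m<n)
... | t , it with progress t m m<n it
... | u , r = u , Iter-snoc it r

EvN⇒∃ : ∀ {S : Set} {R : Rel S} {n Q s} → EvN R n Q s → ∃ Q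
EvN⇒∃ {n = n} (final , progress) with progress⇒Iter progress n ≤-refl
... | t , it = t , final t it

EvN-mono : ∀ {S : Set} {R : Rel S} {n} {Q Q′ : Pred S} →
  (∀ {s} → Q s → Q′ s) → ∀ {s} → EvN R n Q s → EvN R n Q′ s
EvN-mono Q⊆Q′ (final , progress) = (λ s' it → Q⊆Q′ (final s' it)) , progress

theorem4 : (S : Set) (R : Rel S)
    (P× Q× : Pred (S × S)) (F× : Rel (S × S))
    (P Q : Pred S) (F : Rel S) (c₀ c₁ : S → ℕ)
    → Ensures2 R P× Q× F× c₀ c₁
    → (∀ s₁ → P s₁ → ∃ λ s₀ → P× (s₀ , s₁))
    → (∀ s₀ s₁ → Q× (s₀ , s₁) → Q s₁)
    → (∃ λ (F' : Rel S) → ∀ s₀ s₁ s₀' s₁' →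
         F× (s₀ , s₁) (s₀' , s₁') ⇔ (F' s₀ s₀' × F s₁ s₁'))
    → EnsuresN R P Q F c₁
theorem4 _ _ _ Q× F× _ Q F _ _ ensures2 lift Q×⇒Q (F' , F×⇔F'×F) s₁ Ps₁
  with lift s₁ Ps₁
... | s₀ , P×s₀s₁ with EvN⇒∃ (ensures2 s₀ s₁ P×s₀s₁)
... | s₀' , right-run = EvN-mono project right-run
  where
  project : ∀ {s₁'} → Q× (s₀' , s₁') × F× (s₀ , s₁) (s₀' , s₁') → Q s₁' × F s₁ s₁'
  project {s₁'} (q× , f×) =
    Q×⇒Q s₀' s₁' q× , proj₂ (Equivalence.to (F×⇔F'×F s₀ s₁ s₀' s₁') f×)
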